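{- Let $\mathbb{F}$ be a field. For each integer $n\geq 0$ let $R(n)$ be a finite set, with $|R(0)|=1$, and let $C(n)$ be the set of compositions of $n$. For each $n\geq 0$ let $A_n$ be an $R(n)\times C(n)$ matrix and $B_n$ a $C(n)\times R(n)$ matrix with entries in $\mathbb{F}$, written $A(\lambda,\beta)=A_n(\lambda,\beta)$ and $B(\beta,\mu)=B_n(\beta,\mu)$, with $A_0=B_0=[1]$. Suppose that for each $n>0$, each $\lambda\in R(n)$ and each $L\in\{1,\dots,n\}$ there is a finite set $S(\lambda,L)\subseteq R(n-L)$ and weights $\mathrm{wt}_A(\lambda,\gamma)\in\mathbb{F}$ ($\gamma\in S(\lambda,L)$) such that for all $\lambda\in R(n)$ and $\beta\in C(n)$, $$A(\lambda,\beta)=\sum_{\gamma\in S(\lambda,L(\beta))}\mathrm{wt}_A(\lambda,\gamma)\,A(\gamma,\beta^*),$$ and that for each $n>0$, $\mu\in R(n)$ and $L\in\{1,\dots,n\}$ there is a finite set $T(\mu,L)\subseteq R(n-L)$ and weights $\mathrm{wt}_B(\mu,\delta)\in\mathbb{F}$ ($\delta\in T(\mu,L)$) such that for all $\beta\in C(n)$ and $\mu\in R(n)$, $$B(\beta,\mu)=\sum_{\delta\in T(\mu,L(\beta))}\mathrm{wt}_B(\mu,\delta)\,B(\beta^*,\delta).$$ Then the family of identities $A_nB_n=I_{R(n)}$ for all $n\geq 0$ holds if and only if for all $n>0$ and all $\lambda,\mu\in R(n)$, $$\sum_{L=1}^n\ \sum_{\gamma\in S(\lambda,L)\cap T(\m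u,L)}\mathrm{wt}_A(\lambda,\gamma)\,\mathrm{wt}_B(\mu,\gamma)=\chi(\lambda=\mu).$$
   Context: A composition of $n$ is a finite list $\beta=(\beta_1,\dots,\beta_s)$ of positive integers with sum $n$; $C(0)$ consists of the empty list. For $\beta$ nonempty, $L(\beta)=\beta_s$ is its last part and $\beta^*=(\beta_1,\dots,\beta_{s-1})$ is its truncation (a composition of $n-\beta_s$). An $R\times C$ matrix is a function $R\times C\to\mathbb{F}$. $\chi(Q)$ is $1$ if statement $Q$ is true and $0$ otherwise; $I_R$ is the identity matrix indexed by $R$. -}

module Defs where

open import Level using (Level; _⊔_) renaming (suc to lsuc)
open import Data.Nat using (ℕ; zero; suc; _∸_)
open import Data.Fin using (Fin; toℕ)
open import Data.Fin.Subset using (Subset)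
open import Data.Vec using (lookup)
open import Data.List using (List; []; _∷_; [_]; map; concatMap; foldr)
open import Data.List.Base using (allFin)
open import Data.Bool using (Bool; if_then_else_)
open import Data.Product using (∃)
open import Relation.Nullary using (¬_)
open import Relation.Nullary.Decidable using (⌊_⌋)
open import Algebra.Bundles using (CommutativeRing)
import Algebra.Definitions.RawMonoid as RawMonoidDefs
import Data.Fin as Fin

record Field (c ℓ : Level) : Set (lsuc (c ⊔ ℓ)) where
  field
    commutativeRing : CommutativeRing c ℓ
  open CommutativeRing commutativeRing public
  field
    0≉1     : ¬ (0# ≈ 1#)
    inverse : ∀ x → ¬ (x ≈ 0#) → ∃ λ y → x * y ≈ 1#

-- Compositions of n, built from the right ("snoc"):
--   Comp 0 has only the empty composition [] ;
--   snoc L β* is the composition β* followed by the last part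
--   toℕ L + 1 ∈ {1,…,n}, where β* is a composition of n - (toℕ L + 1).
-- Hence for a nonempty composition β = snoc L β*, the last part
-- L(β) = toℕ L + 1 and the truncation β* : Comp (n ∸ suc (toℕ L)).

data Comp : ℕ → Set where
  []   : Comp zero
  snoc : ∀ {n} (L : Fin n) → Comp (n ∸ suc (toℕ L)) → Comp n

lastPart : ∀ {n} → Comp n → ℕ
lastPart []         = 0
lastPart (snoc L _) = suc (toℕ L)

-- The list of all compositions of n (each exactly once), by recursion on
-- the last part. A fuel argument ≥ n is used to make termination evident.
compsF : ℕ → (n : ℕ) → List (Comp n)
compsF _        zero    = [ [] ]
compsF zero     (suc n) = []
compsF (suc f)  (suc n) =
  concatMap (λ L → map (snoc L) (compsF f (n ∸ toℕ L))) (allFin (suc n))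

comps : (n : ℕ) → List (Comp n)
comps n = compsF n n

module FieldSums {c ℓ : Level} (F : Field c ℓ) where
  open Field F

  ΣFin : ∀ {k} → (Fin k → Carrier) → Carrier
  ΣFin = RawMonoidDefs.sum +-rawMonoid

  ΣSub : ∀ {k} → Subset k → (Fin k → Carrier) → Carrier
  ΣSub X f = ΣFin (λ i → if lookup X i then f i else 0#)

  ΣComp : (n : ℕ) → (Comp n → Carrier) → Carrier
  ΣComp n f = foldr (λ β s → f β + s) 0# (comps n)

  χ≡ : ∀ {k} → Fin k → Fin k → Carrier
  χ≡ i j = if ⌊ i Fin.≟ j ⌋ then 1# else 0#

{-# OPTIONS --safe #-}
module Submission where

-- Splitting the sum over compositions of n by the last part L and inserting
-- both recursions gives
--   (A_n B_n)(λ, μ) = Σ_L Σ_{γ,δ} wtA(λ,γ) wtB(μ,δ) (A_{n-L} B_{n-L})(γ, δ).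
-- When all the smaller products are identity matrices the inner sum collapses
-- to γ = δ, leaving exactly the weight sum of the criterion.  So, given
-- A_m B_m = I for all m < n, the criterion at n is equivalent to A_n B_n = I,
-- and strong induction from A_0 B_0 = [1] gives both implications.

open import Defs
open import Level using (Level)
open import Data.Nat using (ℕ; zero; suc; _∸_; _<_; _≤_; s≤s; z<s)
open import Data.Nat.Properties using (≤-refl; ≤-trans; m∸n≤m)
open import Data.Nat.Induction using (<-rec)
open import Data.Fin using (Fin; zero; suc; toℕ)
import Data.Fin as Fin
open import Data.Fin.Subset using (Subset; _∩_)
open import Data.Vec using (lookup)
open import Data.Vec.Properties using (lookup-zipWith)
open import Data.Bool using (true; false; if_then_else_; _∧_)
open import Data.List using (List; []; _∷_; _++_; map; concat; concatMap; foldr; tabulate; allFin)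
open import Data.List.Properties using (map-cong)
open import Function using (_∘_; id)
open import Function.Bundles using (_⇔_; mk⇔)
open import Relation.Binary.PropositionalEquality as ≡ using (_≡_; _≢_)
open import Relation.Nullary using (yes; no; contradiction)
open import Algebra.Bundles using (CommutativeSemiring)

compsF-fuel-irrelevant : ∀ {f g} n → n ≤ f → n ≤ g → compsF f n ≡ compsF g n
compsF-fuel-irrelevant zero _ _ = ≡.refl
compsF-fuel-irrelevant {suc f} {suc g} (suc n) (s≤s n≤f) (s≤s n≤g) =
  ≡.cong concat (map-cong (λ L → ≡.cong (map (snoc L))
    (compsF-fuel-irrelevant (n ∸ toℕ L)
      (≤-trans (m∸n≤m n (toℕ L)) n≤f) (≤-trans (m∸n≤m n (toℕ L)) n≤g)))
    (allFin (suc n)))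

compsF-enough-fuel : ∀ {f} n → n ≤ f → compsF f n ≡ comps n
compsF-enough-fuel n n≤f = compsF-fuel-irrelevant n n≤f ≤-refl

Fin-singleton : ∀ {k} → k ≡ 1 → (i j : Fin k) → i ≡ j
Fin-singleton ≡.refl zero zero = ≡.refl

module ListSum {c ℓ : Level} (R : CommutativeSemiring c ℓ) where
  open CommutativeSemiring R hiding (zero)
  open import Algebra.Properties.Semiring.Sum semiring
    using (sum; sum-cong-≋; sum-replicate-zero; ∑-distrib-+; *-distribˡ-sum; *-distribʳ-sum)
  open import Algebra.Properties.CommutativeSemigroup *-commutativeSemigroup using (interchange)
  open import Relation.Binary.Reasoning.Setoid setoid

  private variable
    a b : Level
    X : Set a
    Y : Set b

  ΣList : List X → (X → Carrier) → Carrier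
  ΣList xs f = foldr (λ x s → f x + s) 0# xs

  ΣList-cong : ∀ (xs : List X) {f g : X → Carrier} → (∀ x → f x ≈ g x) → ΣList xs f ≈ ΣList xs g
  ΣList-cong []       f≈g = refl
  ΣList-cong (x ∷ xs) f≈g = +-cong (f≈g x) (ΣList-cong xs f≈g)

  ΣList-++ : ∀ (xs ys : List X) f → ΣList (xs ++ ys) f ≈ ΣList xs f + ΣList ys f
  ΣList-++ []       ys f = sym (+-identityˡ _)
  ΣList-++ (x ∷ xs) ys f = trans (+-congˡ (ΣList-++ xs ys f)) (sym (+-assoc _ _ _))

  ΣList-map : ∀ (h : X → Y) (xs : List X) f → ΣList (map h xs) f ≡ ΣList xs (f ∘ h)
  ΣList-map h []       f = ≡.refl
  ΣList-map h (x ∷ xs) f = ≡.cong (f (h x) +_) (ΣList-map h xs f)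

  ΣList-concatMap : ∀ (h : X → List Y) (xs : List X) f →
    ΣList (concatMap h xs) f ≈ ΣList xs (λ x → ΣList (h x) f)
  ΣList-concatMap h []       f = refl
  ΣList-concatMap h (x ∷ xs) f = trans (ΣList-++ (h x) (concatMap h xs) f) (+-congˡ (ΣList-concatMap h xs f))

  ΣList-tabulate : ∀ {k} (g : Fin k → X) f → ΣList (tabulate g) f ≡ sum (f ∘ g)
  ΣList-tabulate {k = zero}  g f = ≡.refl
  ΣList-tabulate {k = suc k} g f = ≡.cong (f (g zero) +_) (ΣList-tabulate (g ∘ suc) f)

  ΣList-sum-comm : ∀ {k} (xs : List X) (h : X → Fin k → Carrier) →
    ΣList xs (λ x → sum (h x)) ≈ sum (λ i → ΣList xs (λ x → h x i))
  ΣList-sum-comm {k = k} []       h = sym (sum-replicate-zero k)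
  ΣList-sum-comm         (x ∷ xs) h = trans (+-congˡ (ΣList-sum-comm xs h)) (sym (∑-distrib-+ (h x) _))

  *-distribˡ-ΣList : ∀ (xs : List X) u f → u * ΣList xs f ≈ ΣList xs (λ x → u * f x)
  *-distribˡ-ΣList []       u f = zeroʳ u
  *-distribˡ-ΣList (x ∷ xs) u f = trans (distribˡ u _ _) (+-congˡ (*-distribˡ-ΣList xs u f))

  sum-*-sum : ∀ {p q} (f : Fin p → Carrier) (g : Fin q → Carrier) →
    sum f * sum g ≈ sum (λ i → sum (λ j → f i * g j))
  sum-*-sum f g = trans (*-distribʳ-sum (sum g) f) (sum-cong-≋ (λ i → *-distribˡ-sum (f i) g))

  ΣList-bilinear : ∀ {p q} (xs : List X) (u : Fin p → Carrier) (v : Fin q → Carrier)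
    (P : Fin p → X → Carrier) (Q : X → Fin q → Carrier) →
    ΣList xs (λ x → sum (λ i → u i * P i x) * sum (λ j → v j * Q x j))
      ≈ sum (λ i → sum (λ j → (u i * v j) * ΣList xs (λ x → P i x * Q x j)))
  ΣList-bilinear xs u v P Q = begin
      ΣList xs (λ x → sum (λ i → u i * P i x) * sum (λ j → v j * Q x j))
    ≈⟨ ΣList-cong xs (λ x → trans (sum-*-sum (λ i → u i * P i x) (λ j → v j * Q x j))
         (sum-cong-≋ (λ i → sum-cong-≋ (λ j → interchange (u i) (P i x) (v j) (Q x j))))) ⟩
      ΣList xs (λ x → sum (λ i → sum (λ j → (u i * v j) * (P i x * Q x j))))
    ≈⟨ ΣList-sum-comm xs (λ x i → sum (λ j → (u i * v j) * (P i x * Q x j))) ⟩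
      sum (λ i → ΣList xs (λ x → sum (λ j → (u i * v j) * (P i x * Q x j))))
    ≈⟨ sum-cong-≋ (λ i → ΣList-sum-comm xs (λ x j → (u i * v j) * (P i x * Q x j))) ⟩
      sum (λ i → sum (λ j → ΣList xs (λ x → (u i * v j) * (P i x * Q x j))))
    ≈⟨ sum-cong-≋ (λ i → sum-cong-≋ (λ j →
         sym (*-distribˡ-ΣList xs (u i * v j) (λ x → P i x * Q x j)))) ⟩
      sum (λ i → sum (λ j → (u i * v j) * ΣList xs (λ x → P i x * Q x j))) ∎

module FieldSumProperties {c ℓ : Level} (F : Field c ℓ) where
  open Field F hiding (zero)
  open FieldSums F
  open ListSum commutativeSemiring
    using (ΣList; ΣList-cong; ΣList-map; ΣList-concatMap; ΣList-tabulate; ΣList-bilinear)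
  open import Algebra.Properties.Semiring.Sum semiring using (sum-cong-≋; sum-replicate-zero)
  open import Relation.Binary.Reasoning.Setoid setoid

  ΣComp-snoc : ∀ k (h : Comp (suc k) → Carrier) →
    ΣComp (suc k) h ≈ ΣFin (λ L → ΣComp (k ∸ toℕ L) (h ∘ snoc L))
  ΣComp-snoc k h = begin
      ΣList (concatMap (λ L → map (snoc L) (compsF k (k ∸ toℕ L))) (allFin (suc k))) h
    ≈⟨ ΣList-concatMap (λ L → map (snoc L) (compsF k (k ∸ toℕ L))) (allFin (suc k)) h ⟩
      ΣList (allFin (suc k)) (λ L → ΣList (map (snoc L) (compsF k (k ∸ toℕ L))) h)
    ≡⟨ ΣList-tabulate id (λ L → ΣList (map (snoc L) (compsF k (k ∸ toℕ L))) h) ⟩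
      ΣFin (λ L → ΣList (map (snoc L) (compsF k (k ∸ toℕ L))) h)
    ≈⟨ sum-cong-≋ (λ L → reflexive (≡.trans (ΣList-map (snoc L) (compsF k (k ∸ toℕ L)) h)
         (≡.cong (λ βs → ΣList βs (h ∘ snoc L))
           (compsF-enough-fuel (k ∸ toℕ L) (m∸n≤m k (toℕ L)))))) ⟩
      ΣFin (λ L → ΣComp (k ∸ toℕ L) (h ∘ snoc L)) ∎

  restrict : ∀ {k} → Subset k → (Fin k → Carrier) → Fin k → Carrier
  restrict X f i = if lookup X i then f i else 0#

  restrict-*ʳ : ∀ {k} (X : Subset k) (f g : Fin k → Carrier) i →
    restrict X (λ j → f j * g j) i ≈ restrict X f i * g i
  restrict-*ʳ X f g i with lookup X i
  ... | true  = refl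
  ... | false = sym (zeroˡ (g i))

  restrict-∩ : ∀ {k} (X Y : Subset k) (f g : Fin k → Carrier) i →
    restrict (X ∩ Y) (λ j → f j * g j) i ≈ restrict X f i * restrict Y g i
  restrict-∩ X Y f g i rewrite lookup-zipWith _∧_ i X Y with lookup X i | lookup Y i
  ... | true  | true  = refl
  ... | true  | false = sym (zeroʳ (f i))
  ... | false | _     = sym (zeroˡ _)

  χ≡-refl : ∀ {k} (i : Fin k) → χ≡ i i ≡ 1#
  χ≡-refl i with i Fin.≟ i
  ... | yes _   = ≡.refl
  ... | no i≢i  = contradiction ≡.refl i≢i

  χ≡-≢ : ∀ {k} {i j : Fin k} → i ≢ j → χ≡ i j ≡ 0#
  χ≡-≢ {i = i} {j} i≢j with i Fin.≟ j
  ... | yes i≡j = contradiction i≡j i≢j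
  ... | no _    = ≡.refl

  -- suc i ≟ suc j is i ≟ j mapped along suc, so both sides compute once i ≟ j is split.
  χ≡-suc : ∀ {k} (i j : Fin k) → χ≡ (suc i) (suc j) ≡ χ≡ i j
  χ≡-suc i j with i Fin.≟ j
  ... | yes _ = ≡.refl
  ... | no _  = ≡.refl

  ΣFin-*-χ≡ : ∀ {k} (f : Fin k → Carrier) (i : Fin k) → ΣFin (λ j → f j * χ≡ i j) ≈ f i
  ΣFin-*-χ≡ {suc k} f zero = begin
      f zero * χ≡ {suc k} zero zero + ΣFin {k} (λ j → f (suc j) * χ≡ zero (suc j))
    ≈⟨ +-cong (*-congˡ (reflexive (χ≡-refl {suc k} zero)))
              (sum-cong-≋ {k} (λ j → *-congˡ (reflexive (χ≡-≢ {i = zero} {suc j} λ ())))) ⟩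
      f zero * 1# + ΣFin {k} (λ j → f (suc j) * 0#)
    ≈⟨ +-cong (*-identityʳ _) (trans (sum-cong-≋ (λ j → zeroʳ (f (suc j)))) (sum-replicate-zero k)) ⟩
      f zero + 0#
    ≈⟨ +-identityʳ _ ⟩
      f zero ∎
  ΣFin-*-χ≡ {suc k} f (suc i) = begin
      f zero * χ≡ (suc i) zero + ΣFin {k} (λ j → f (suc j) * χ≡ (suc i) (suc j))
    ≈⟨ +-cong (trans (*-congˡ (reflexive (χ≡-≢ {i = suc i} {zero} λ ()))) (zeroʳ (f zero)))
              (sum-cong-≋ (λ j → *-congˡ (reflexive (χ≡-suc i j)))) ⟩
      0# + ΣFin (λ j → f (suc j) * χ≡ i j)
    ≈⟨ +-identityˡ _ ⟩
      ΣFin (λ j → f (suc j) * χ≡ i j)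
    ≈⟨ ΣFin-*-χ≡ (f ∘ suc) i ⟩
      f (suc i) ∎

  ΣFin²-*-identity : ∀ {k} (u v : Fin k → Carrier) (M : Fin k → Fin k → Carrier) →
    (∀ i j → M i j ≈ χ≡ i j) →
    ΣFin (λ i → ΣFin (λ j → (u i * v j) * M i j)) ≈ ΣFin (λ i → u i * v i)
  ΣFin²-*-identity u v M M≈χ≡ = begin
      ΣFin (λ i → ΣFin (λ j → (u i * v j) * M i j))
    ≈⟨ sum-cong-≋ (λ i → sum-cong-≋ (λ j → *-congˡ (M≈χ≡ i j))) ⟩
      ΣFin (λ i → ΣFin (λ j → (u i * v j) * χ≡ i j))
    ≈⟨ sum-cong-≋ (λ i → ΣFin-*-χ≡ (λ j → u i * v j) i) ⟩
      ΣFin (λ i → u i * v i) ∎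

  module Recursion
      (r : ℕ → ℕ)
      (A : (n : ℕ) → Fin (r n) → Comp n → Carrier)
      (B : (n : ℕ) → Comp n → Fin (r n) → Carrier)
      (S : (n : ℕ) → Fin (r n) → (L : Fin n) → Subset (r (n ∸ suc (toℕ L))))
      (wtA : (n : ℕ) → Fin (r n) → (L : Fin n) → Fin (r (n ∸ suc (toℕ L))) → Carrier)
      (T : (n : ℕ) → Fin (r n) → (L : Fin n) → Subset (r (n ∸ suc (toℕ L))))
      (wtB : (n : ℕ) → Fin (r n) → (L : Fin n) → Fin (r (n ∸ suc (toℕ L))) → Carrier)
      (A-snoc : ∀ n (λ' : Fin (r n)) (L : Fin n) (β* : Comp (n ∸ suc (toℕ L))) →
        A n λ' (snoc L β*) ≈ ΣSub (S n λ' L) (λ γ → wtA n λ' L γ * A (n ∸ suc (toℕ L)) γ β*))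
      (B-snoc : ∀ n (μ : Fin (r n)) (L : Fin n) (β* : Comp (n ∸ suc (toℕ L))) →
        B n (snoc L β*) μ ≈ ΣSub (T n μ L) (λ δ → wtB n μ L δ * B (n ∸ suc (toℕ L)) β* δ))
    where

    AB : ∀ n → Fin (r n) → Fin (r n) → Carrier
    AB n λ' μ = ΣComp n (λ β → A n λ' β * B n β μ)

    pairing : ∀ n → Fin (r n) → Fin (r n) → Carrier
    pairing n λ' μ = ΣFin (λ L → ΣSub (S n λ' L ∩ T n μ L) (λ γ → wtA n λ' L γ * wtB n μ L γ))

    IsIdentity : (∀ n → Fin (r n) → Fin (r n) → Carrier) → ℕ → Set ℓ
    IsIdentity M n = ∀ λ' μ → M n λ' μ ≈ χ≡ λ' μ

    wtA∣S : ∀ n → Fin (r n) → (L : Fin n) → Fin (r (n ∸ suc (toℕ L))) → Carrier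
    wtA∣S n λ' L = restrict (S n λ' L) (wtA n λ' L)

    wtB∣T : ∀ n → Fin (r n) → (L : Fin n) → Fin (r (n ∸ suc (toℕ L))) → Carrier
    wtB∣T n μ L = restrict (T n μ L) (wtB n μ L)

    AB-suc : ∀ k λ' μ → AB (suc k) λ' μ ≈
      ΣFin (λ L → ΣFin (λ γ → ΣFin (λ δ →
        (wtA∣S (suc k) λ' L γ * wtB∣T (suc k) μ L δ) * AB (k ∸ toℕ L) γ δ)))
    AB-suc k λ' μ = begin
        AB (suc k) λ' μ
      ≈⟨ ΣComp-snoc k (λ β → A (suc k) λ' β * B (suc k) β μ) ⟩
        ΣFin (λ L → ΣComp (k ∸ toℕ L) (λ β* → A (suc k) λ' (snoc L β*) * B (suc k) (snoc L β*) μ))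
      ≈⟨ sum-cong-≋ (λ L → ΣList-cong (comps (k ∸ toℕ L)) (λ β* → *-cong
           (trans (A-snoc (suc k) λ' L β*) (sum-cong-≋ (restrict-*ʳ (S (suc k) λ' L) _ _)))
           (trans (B-snoc (suc k) μ L β*) (sum-cong-≋ (restrict-*ʳ (T (suc k) μ L) _ _))))) ⟩
        ΣFin (λ L → ΣComp (k ∸ toℕ L) (λ β* →
          ΣFin (λ γ → wtA∣S (suc k) λ' L γ * A (k ∸ toℕ L) γ β*) *
          ΣFin (λ δ → wtB∣T (suc k) μ L δ * B (k ∸ toℕ L) β* δ)))
      ≈⟨ sum-cong-≋ (λ L → ΣList-bilinear (comps (k ∸ toℕ L))
           (wtA∣S (suc k) λ' L) (wtB∣T (suc k) μ L) (A (k ∸ toℕ L)) (B (k ∸ toℕ L))) ⟩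
        ΣFin (λ L → ΣFin (λ γ → ΣFin (λ δ →
          (wtA∣S (suc k) λ' L γ * wtB∣T (suc k) μ L δ) * AB (k ∸ toℕ L) γ δ))) ∎

    AB-suc≈pairing : ∀ k → (∀ (L : Fin (suc k)) → IsIdentity AB (k ∸ toℕ L)) →
      ∀ λ' μ → AB (suc k) λ' μ ≈ pairing (suc k) λ' μ
    AB-suc≈pairing k I λ' μ = trans (AB-suc k λ' μ) (sum-cong-≋ λ L → trans
      (ΣFin²-*-identity (wtA∣S (suc k) λ' L) (wtB∣T (suc k) μ L) (AB (k ∸ toℕ L)) (I L))
      (sym (sum-cong-≋ (restrict-∩ (S (suc k) λ' L) (T (suc k) μ L) (wtA (suc k) λ' L) (wtB (suc k) μ L)))))

    AB-zero-identity : r 0 ≡ 1 → (∀ λ' β → A 0 λ' β ≈ 1#) → (∀ β μ → B 0 β μ ≈ 1#) →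
      IsIdentity AB 0
    AB-zero-identity r0≡1 A₀≈1 B₀≈1 λ' μ rewrite Fin-singleton r0≡1 λ' μ = begin
        A 0 μ [] * B 0 [] μ + 0#
      ≈⟨ +-identityʳ _ ⟩
        A 0 μ [] * B 0 [] μ
      ≈⟨ *-cong (A₀≈1 μ []) (B₀≈1 [] μ) ⟩
        1# * 1#
      ≈⟨ *-identityʳ 1# ⟩
        1#
      ≡⟨ ≡.sym (χ≡-refl μ) ⟩
        χ≡ μ μ ∎

    identity⇒pairing : (∀ n → IsIdentity AB n) → ∀ n → 0 < n → IsIdentity pairing n
    identity⇒pairing I (suc k) _ λ' μ =
      trans (sym (AB-suc≈pairing k (λ L → I (k ∸ toℕ L)) λ' μ)) (I (suc k) λ' μ)

    pairing⇒identity : IsIdentity AB 0 → (∀ n → 0 < n → IsIdentity pairing n) → ∀ n → IsIdentity AB n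
    pairing⇒identity I₀ P = <-rec (IsIdentity AB) step
      where
      step : ∀ n → (∀ {m} → m < n → IsIdentity AB m) → IsIdentity AB n
      step zero    _  = I₀
      step (suc k) IH λ' μ =
        trans (AB-suc≈pairing k (λ L → IH (s≤s (m∸n≤m k (toℕ L)))) λ' μ) (P (suc k) z<s λ' μ)

theorem2p2 : ∀ {c ℓ : Level} (F : Field c ℓ) → let open Field F in let open FieldSums F in
    (r : ℕ → ℕ) → r 0 ≡ 1 →
    (A : (n : ℕ) → Fin (r n) → Comp n → Carrier) →
    (B : (n : ℕ) → Comp n → Fin (r n) → Carrier) →
    (∀ λ' β → A 0 λ' β ≈ 1#) →
    (∀ β μ → B 0 β μ ≈ 1#) →
    (S : (n : ℕ) → Fin (r n) → (L : Fin n) → Subset (r (n ∸ suc (toℕ L)))) →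
    (wtA : (n : ℕ) → Fin (r n) → (L : Fin n) → Fin (r (n ∸ suc (toℕ L))) → Carrier) →
    (T : (n : ℕ) → Fin (r n) → (L : Fin n) → Subset (r (n ∸ suc (toℕ L)))) →
    (wtB : (n : ℕ) → Fin (r n) → (L : Fin n) → Fin (r (n ∸ suc (toℕ L))) → Carrier) →
    (∀ n (λ' : Fin (r n)) (L : Fin n) (β* : Comp (n ∸ suc (toℕ L))) →
      A n λ' (snoc L β*) ≈ ΣSub (S n λ' L) (λ γ → wtA n λ' L γ * A (n ∸ suc (toℕ L)) γ β*)) →
    (∀ n (μ : Fin (r n)) (L : Fin n) (β* : Comp (n ∸ suc (toℕ L))) →
      B n (snoc L β*) μ ≈ ΣSub (T n μ L) (λ δ → wtB n μ L δ * B (n ∸ suc (toℕ L)) β* δ)) →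
    (∀ n (λ' μ : Fin (r n)) → ΣComp n (λ β → A n λ' β * B n β μ) ≈ χ≡ λ' μ)
      ⇔
    (∀ n → 0 < n → ∀ (λ' μ : Fin (r n)) →
      ΣFin (λ (L : Fin n) → ΣSub (S n λ' L ∩ T n μ L) (λ γ → wtA n λ' L γ * wtB n μ L γ)) ≈ χ≡ λ' μ)
theorem2p2 F r r0≡1 A B A₀≈1 B₀≈1 S wtA T wtB A-snoc B-snoc =
  mk⇔ identity⇒pairing (pairing⇒identity (AB-zero-identity r0≡1 A₀≈1 B₀≈1))
  where open FieldSumProperties.Recursion F r A B S wtA T wtB A-snoc B-snoc
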